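{- Let $\zeta$ be a primitive third root of unity. There is no field $K$ containing $\zeta$ together with automorphisms $\sigma,\tau$ of $K$ satisfying $\tau\sigma=\sigma^{ -1}\tau$, such that for some $b\in K$ and some odd $n\in\mathbb{N}$ we have: (1) $\sigma(\zeta)=\tau(\zeta)=\zeta^2$; (2) $\sigma^n(b)=\zeta^i b$ for some $i\in\{0,1,2\}$; (3) $\tau(b)=\zeta\sigma(b)$.
   Context: Here $(K,\sigma,\tau)$ with $\tau\sigma=\sigma^{ -1}\tau$ is a field with an action of the group $\mathbb{Z}\rtimes\mathbb{Z}=\langle\sigma,\tau\mid\tau\sigma=\sigma^{ -1}\tau\rangle$ by automorphisms. -}

module Defs where

open import Level using (Level; _⊔_)
open import Data.Nat using (ℕ; zero; suc) renaming (_*_ to _*ℕ_)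
open import Data.Product using (∃; Σ-syntax; _×_)
open import Relation.Binary.PropositionalEquality using (_≡_)
open import Relation.Nullary using (¬_)
open import Algebra.Bundles using (CommutativeRing)
import Algebra.Bundles
open import Algebra.Morphism.Structures using (IsRingIsomorphism)
import Algebra.Definitions.RawSemiring as RawSemiringDefs

record Field (c ℓ : Level) : Set (Level.suc (c ⊔ ℓ)) where
  field
    commutativeRing : CommutativeRing c ℓ
  open CommutativeRing commutativeRing public
  field
    0≉1     : ¬ (0# ≈ 1#)
    inverse : ∀ x → ¬ (x ≈ 0#) → ∃ λ y → x * y ≈ 1#

  open RawSemiringDefs (Algebra.Bundles.Semiring.rawSemiring semiring) public using (_^_)

module _ {c ℓ : Level} (K : Field c ℓ) where
  open Field K

  record Automorphism : Set (c ⊔ ℓ) where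
    field
      map               : Carrier → Carrier
      inv               : Carrier → Carrier
      isRingIsomorphism : IsRingIsomorphism rawRing rawRing map
      map∘inv           : ∀ x → map (inv x) ≈ x
      inv∘map           : ∀ x → inv (map x) ≈ x

  PrimitiveCubeRoot : Carrier → Set ℓ
  PrimitiveCubeRoot ζ = ((ζ ^ 3) ≈ 1#) × ¬ (ζ ≈ 1#)

iter : ∀ {a} {A : Set a} → (A → A) → ℕ → A → A
iter f zero    x = x
iter f (suc n) x = f (iter f n x)

Odd : ℕ → Set
Odd n = ∃ λ k → n ≡ suc (2 *ℕ k)

-- Both σ and τ invert ζ, and the relation τσ = σ⁻¹τ gives τ = σⁿ τ σⁿ. Write
-- σⁿ(b) = c b with c = ζⁱ. Applying σⁿ τ to c b, and using that the odd power
-- σⁿ also inverts ζ (hence c), so that σⁿ τ fixes c while σ inverts it, one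
-- finds τ(b) = σⁿ(ζ) σ(b). Comparing with τ(b) = ζ σ(b) gives ζ = σⁿ(ζ) = ζ⁻¹,
-- so ζ² = 1 = ζ³ and ζ = 1.
module Submission where

open import Defs
open import Level using (_⊔_)
open import Data.Nat using (ℕ; zero; suc) renaming (_*_ to _*ℕ_)
open import Data.Nat.Properties using (*-suc)
open import Data.Fin using (Fin; toℕ)
open import Data.Product using (Σ; Σ-syntax; _×_; _,_)
open import Relation.Nullary using (¬_)
open import Relation.Binary.PropositionalEquality as ≡ using (_≡_)
open import Algebra.Bundles using (CommutativeMonoid)
open import Algebra.Morphism.Structures using (IsRingHomomorphism; IsRingIsomorphism)
import Algebra.Morphism.Construct.Composition as Composition
import Algebra.Morphism.Construct.Identity as Identity
import Algebra.Properties.CommutativeSemigroup as CommutativeSemigroupProperties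
import Relation.Binary.Reasoning.Setoid as SetoidReasoning

iter-commute : ∀ {a} {A : Set a} (f : A → A) n x → iter f n (f x) ≡ f (iter f n x)
iter-commute f zero    x = ≡.refl
iter-commute f (suc n) x = ≡.cong f (iter-commute f n x)

module _ {a ℓ} (M : CommutativeMonoid a ℓ) where
  open CommutativeMonoid M
  open CommutativeSemigroupProperties commutativeSemigroup using (x∙yz≈y∙xz)
  open SetoidReasoning setoid

  inverse-unique : ∀ {x y z} → x ∙ z ≈ ε → y ∙ z ≈ ε → x ≈ y
  inverse-unique {x} {y} {z} xz≈ε yz≈ε = begin
    x            ≈⟨ identityʳ x ⟨
    x ∙ ε        ≈⟨ ∙-congˡ yz≈ε ⟨
    x ∙ (y ∙ z)  ≈⟨ x∙yz≈y∙xz x y z ⟩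
    y ∙ (x ∙ z)  ≈⟨ ∙-congˡ xz≈ε ⟩
    y ∙ ε        ≈⟨ identityʳ y ⟩
    y            ∎

module FieldProperties {c ℓ} (K : Field c ℓ) where
  open Field K
  open CommutativeSemigroupProperties *-commutativeSemigroup using (interchange; x∙yz≈y∙xz)
  open SetoidReasoning setoid

  *-cancelʳ-nonzero : ∀ {x y z} → ¬ (z ≈ 0#) → x * z ≈ y * z → x ≈ y
  *-cancelʳ-nonzero {x} {y} {z} z≉0 xz≈yz with inverse z z≉0
  ... | w , zw≈1 = begin
    x            ≈⟨ *-identityʳ x ⟨
    x * 1#       ≈⟨ *-congˡ zw≈1 ⟨
    x * (z * w)  ≈⟨ *-assoc x z w ⟨
    (x * z) * w  ≈⟨ *-congʳ xz≈yz ⟩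
    (y * z) * w  ≈⟨ *-assoc y z w ⟩
    y * (z * w)  ≈⟨ *-congˡ zw≈1 ⟩
    y * 1#       ≈⟨ *-identityʳ y ⟩
    y            ∎

  IsEndomorphism : (Carrier → Carrier) → Set (c ⊔ ℓ)
  IsEndomorphism = IsRingHomomorphism rawRing rawRing

  iter-isEndomorphism : ∀ {f} → IsEndomorphism f → ∀ n → IsEndomorphism (iter f n)
  iter-isEndomorphism f-hom zero    = Identity.isRingHomomorphism rawRing refl
  iter-isEndomorphism f-hom (suc n) =
    Composition.isRingHomomorphism trans (iter-isEndomorphism f-hom n) f-hom

  Inverts : (Carrier → Carrier) → Carrier → Set ℓ
  Inverts f x = f x * x ≈ 1#

  inverts-^ : ∀ {f x} → IsEndomorphism f → Inverts f x → ∀ k → Inverts f (x ^ k)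
  inverts-^ f-hom fx*x≈1 zero = trans (*-congʳ 1#-homo) (*-identityʳ 1#)
    where open IsRingHomomorphism f-hom
  inverts-^ {f} {x} f-hom fx*x≈1 (suc k) = begin
    f (x * x ^ k) * (x * x ^ k)        ≈⟨ *-congʳ (*-homo x (x ^ k)) ⟩
    (f x * f (x ^ k)) * (x * x ^ k)    ≈⟨ interchange (f x) (f (x ^ k)) x (x ^ k) ⟩
    (f x * x) * (f (x ^ k) * x ^ k)    ≈⟨ *-cong fx*x≈1 (inverts-^ f-hom fx*x≈1 k) ⟩
    1# * 1#                            ≈⟨ *-identityʳ 1# ⟩
    1#                                 ∎
    where open IsRingHomomorphism f-hom

  inverts-∘ : ∀ {f g x} → IsEndomorphism g → Inverts f x → Inverts g x → g (f x) ≈ x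
  inverts-∘ {f} {g} {x} g-hom fx*x≈1 gx*x≈1 = inverse-unique *-commutativeMonoid
    (begin
      g (f x) * g x  ≈⟨ *-homo (f x) x ⟨
      g (f x * x)    ≈⟨ ⟦⟧-cong fx*x≈1 ⟩
      g 1#           ≈⟨ 1#-homo ⟩
      1#             ∎)
    (trans (*-comm x (g x)) gx*x≈1)
    where open IsRingHomomorphism g-hom

  iter-even-fixes : ∀ {f x} → IsEndomorphism f → Inverts f x → ∀ k → iter f (2 *ℕ k) x ≈ x
  iter-even-fixes f-hom fx*x≈1 zero = refl
  iter-even-fixes {f} {x} f-hom fx*x≈1 (suc k) =
    ≡.subst (λ m → iter f m x ≈ x) (≡.sym (*-suc 2 k)) (begin
      f (f (iter f (2 *ℕ k) x))  ≈⟨ ⟦⟧-cong (⟦⟧-cong (iter-even-fixes f-hom fx*x≈1 k)) ⟩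
      f (f x)                    ≈⟨ inverts-∘ {f = f} f-hom fx*x≈1 fx*x≈1 ⟩
      x                          ∎)
    where open IsRingHomomorphism f-hom

  iter-odd-inverts : ∀ {f x n} → IsEndomorphism f → Inverts f x → Odd n → Inverts (iter f n) x
  iter-odd-inverts f-hom fx*x≈1 (k , ≡.refl) =
    trans (*-congʳ (⟦⟧-cong (iter-even-fixes f-hom fx*x≈1 k))) fx*x≈1
    where open IsRingHomomorphism f-hom

  twist-iter : ∀ {s t : Carrier → Carrier} → IsEndomorphism s → (∀ y → s (t (s y)) ≈ t y) →
               ∀ k x → iter s k (t (iter s k x)) ≈ t x
  twist-iter s-hom sts≈t zero    x = refl
  twist-iter {s} {t} s-hom sts≈t (suc k) x = begin
    s (iter s k (t (s (iter s k x))))  ≡⟨ iter-commute s k _ ⟨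
    iter s k (s (t (s (iter s k x))))  ≈⟨ ⟦⟧-cong (sts≈t (iter s k x)) ⟩
    iter s k (t (iter s k x))          ≈⟨ twist-iter {t = t} s-hom sts≈t k x ⟩
    t x                                ∎
    where open IsRingHomomorphism (iter-isEndomorphism s-hom k)

  twist-eigenvector : ∀ {s t n b c ζ} → IsEndomorphism s → IsEndomorphism t →
    (∀ y → s (t (s y)) ≈ t y) →
    Inverts s c → Inverts t c → Inverts (iter s n) c →
    iter s n b ≈ c * b → t b ≈ ζ * s b → t b ≈ iter s n ζ * s b
  twist-eigenvector {s} {t} {n} {b} {c} {ζ} s-hom t-hom sts≈t sc*c≈1 tc*c≈1 gc*c≈1 gb≈cb tb≈ζsb =
    begin
      t b                      ≈⟨ twist-iter {t = t} s-hom sts≈t n b ⟨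
      g (t (g b))              ≈⟨ G.⟦⟧-cong (T.⟦⟧-cong gb≈cb) ⟩
      g (t (c * b))            ≈⟨ G.⟦⟧-cong (T.*-homo c b) ⟩
      g (t c * t b)            ≈⟨ G.*-homo (t c) (t b) ⟩
      g (t c) * g (t b)        ≈⟨ *-cong (inverts-∘ {f = t} g-hom tc*c≈1 gc*c≈1) (G.⟦⟧-cong tb≈ζsb) ⟩
      c * g (ζ * s b)          ≈⟨ *-congˡ (G.*-homo ζ (s b)) ⟩
      c * (g ζ * g (s b))      ≡⟨ ≡.cong (λ y → c * (g ζ * y)) (iter-commute s n b) ⟩
      c * (g ζ * s (g b))      ≈⟨ *-congˡ (*-congˡ (S.⟦⟧-cong gb≈cb)) ⟩
      c * (g ζ * s (c * b))    ≈⟨ *-congˡ (*-congˡ (S.*-homo c b)) ⟩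
      c * (g ζ * (s c * s b))  ≈⟨ x∙yz≈y∙xz c (g ζ) (s c * s b) ⟩
      g ζ * (c * (s c * s b))  ≈⟨ *-congˡ (*-assoc c (s c) (s b)) ⟨
      g ζ * ((c * s c) * s b)  ≈⟨ *-congˡ (*-congʳ (trans (*-comm c (s c)) sc*c≈1)) ⟩
      g ζ * (1# * s b)         ≈⟨ *-congˡ (*-identityˡ (s b)) ⟩
      g ζ * s b                ∎
    where
    g : Carrier → Carrier
    g = iter s n
    g-hom : IsEndomorphism g
    g-hom = iter-isEndomorphism s-hom n
    module S = IsRingHomomorphism s-hom
    module T = IsRingHomomorphism t-hom
    module G = IsRingHomomorphism g-hom

  squaring-inverts-cube-root : ∀ {f ζ} → ζ ^ 3 ≈ 1# → f ζ ≈ ζ ^ 2 → Inverts f ζ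
  squaring-inverts-cube-root {ζ = ζ} ζ³≈1 fζ≈ζ² = trans (*-congʳ fζ≈ζ²) (trans (*-comm (ζ ^ 2) ζ) ζ³≈1)

  cube-root-self-inverse⇒≈1 : ∀ {ζ} → ζ ^ 3 ≈ 1# → ζ * ζ ≈ 1# → ζ ≈ 1#
  cube-root-self-inverse⇒≈1 {ζ} ζ³≈1 ζζ≈1 = begin
    ζ                         ≈⟨ *-identityʳ ζ ⟨
    ζ * 1#                    ≈⟨ *-congˡ ζζ≈1 ⟨
    ζ * (ζ * ζ)               ≈⟨ *-congˡ (*-congˡ (*-identityʳ ζ)) ⟨
    ζ * (ζ * (ζ * 1#))        ≈⟨ ζ³≈1 ⟩
    1#                        ∎

  automorphism-isEndomorphism : (σ : Automorphism K) → IsEndomorphism (Automorphism.map σ)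
  automorphism-isEndomorphism σ = IsRingIsomorphism.isRingHomomorphism (Automorphism.isRingIsomorphism σ)

  automorphism-nonzero : (σ : Automorphism K) → ∀ {x} → ¬ (x ≈ 0#) → ¬ (Automorphism.map σ x ≈ 0#)
  automorphism-nonzero σ x≉0 σx≈0 = x≉0 (injective (trans σx≈0 (sym 0#-homo)))
    where open IsRingIsomorphism (Automorphism.isRingIsomorphism σ)

  τσ≈σ⁻¹τ⇒στσ≈τ : (σ τ : Automorphism K) →
    (∀ x → Automorphism.map τ (Automorphism.map σ x) ≈ Automorphism.inv σ (Automorphism.map τ x)) →
    ∀ y → Automorphism.map σ (Automorphism.map τ (Automorphism.map σ y)) ≈ Automorphism.map τ y
  τσ≈σ⁻¹τ⇒στσ≈τ σ τ τσ≈σ⁻¹τ y =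
    trans (⟦⟧-cong (τσ≈σ⁻¹τ y)) (Automorphism.map∘inv σ (Automorphism.map τ y))
    where open IsRingHomomorphism (automorphism-isEndomorphism σ)

lemma5p2 : ∀ {c ℓ} (K : Field c ℓ) (ζ : Field.Carrier K) → PrimitiveCubeRoot K ζ →
    let open Field K in
    ¬ (Σ[ σ ∈ Automorphism K ] Σ[ τ ∈ Automorphism K ]
         ((∀ x → Automorphism.map τ (Automorphism.map σ x) ≈ Automorphism.inv σ (Automorphism.map τ x))
         × Σ[ b ∈ Carrier ] Σ[ n ∈ ℕ ]
             (¬ (b ≈ 0#)
             × Odd n
             × Automorphism.map σ ζ ≈ ζ ^ 2
             × Automorphism.map τ ζ ≈ ζ ^ 2
             × Σ[ i ∈ Fin 3 ] (iter (Automorphism.map σ) n b ≈ ζ ^ toℕ i * b)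
             × Automorphism.map τ b ≈ ζ * Automorphism.map σ b)))
lemma5p2 K ζ (ζ³≈1 , ζ≉1)
  (σ , τ , τσ≈σ⁻¹τ , b , n , b≉0 , n-odd , σζ≈ζ² , τζ≈ζ² , i , σⁿb≈ζⁱb , τb≈ζσb) =
  ζ≉1 (cube-root-self-inverse⇒≈1 ζ³≈1 (trans (*-congʳ ζ≈sⁿζ) sⁿ-inverts-ζ))
  where
  open Field K
  open FieldProperties K

  s t : Carrier → Carrier
  s = Automorphism.map σ
  t = Automorphism.map τ

  s-hom : IsEndomorphism s
  s-hom = automorphism-isEndomorphism σ
  t-hom : IsEndomorphism t
  t-hom = automorphism-isEndomorphism τ

  s-inverts-ζ : Inverts s ζ
  s-inverts-ζ = squaring-inverts-cube-root {s} ζ³≈1 σζ≈ζ²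
  t-inverts-ζ : Inverts t ζ
  t-inverts-ζ = squaring-inverts-cube-root {t} ζ³≈1 τζ≈ζ²
  sⁿ-inverts-ζ : Inverts (iter s n) ζ
  sⁿ-inverts-ζ = iter-odd-inverts s-hom s-inverts-ζ n-odd

  tb≈sⁿζ*sb : t b ≈ iter s n ζ * s b
  tb≈sⁿζ*sb = twist-eigenvector {n = n} s-hom t-hom (τσ≈σ⁻¹τ⇒στσ≈τ σ τ τσ≈σ⁻¹τ)
    (inverts-^ s-hom s-inverts-ζ (toℕ i)) (inverts-^ t-hom t-inverts-ζ (toℕ i))
    (inverts-^ (iter-isEndomorphism s-hom n) sⁿ-inverts-ζ (toℕ i)) σⁿb≈ζⁱb τb≈ζσb

  ζ≈sⁿζ : ζ ≈ iter s n ζ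
  ζ≈sⁿζ = *-cancelʳ-nonzero (automorphism-nonzero σ b≉0) (trans (sym τb≈ζσb) tb≈sⁿζ*sb)
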